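{- Let $A$ be a finite alphabet and let $\theta$ be a literal antimorphism onto $A^*$ (a bijection $A^*\to A^*$ with $\theta(A)\subseteq A$, $\theta(\varepsilon)=\varepsilon$ and $\theta(xy)=\theta(y)\theta(x)$), with $\theta\ne\theta_0$, where $\theta_0$ is the mirror-image antimorphism $\theta_0(w_1\cdots w_n)=w_n\cdots w_1$ ($w_i\in A$). If $\theta$ is involutive ($\theta^2=\mathrm{id}_{A^*}$), then every non-complete regular $\theta$-invariant code $X\subseteq A^*$ is contained in a complete $\theta$-invariant code.
   Context: $X$ is $\theta$-invariant if $\theta(X)=X$. A code is a set $X$ such that any equation $x_1\cdots x_m=y_1\cdots y_n$ with $x_i,y_j\in X$ forces $m=n$ and $x_i=y_i$. $F(S)$ is the set of factors of words in $S$; $X$ is complete if $F(X^*)=A^*$. Regular means recognizable by a finite automaton. -}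

module Defs where

open import Data.Nat using (ℕ)
open import Data.Fin using (Fin)
open import Data.Bool using (Bool; true)
open import Data.List using (List; []; _∷_; [_]; _++_; concat; reverse; foldl)
open import Data.List.Relation.Unary.All using (All)
open import Data.Product using (Σ; _×_; ∃; ∃-syntax)
open import Relation.Binary.PropositionalEquality using (_≡_)
open import Relation.Nullary using (¬_)
open import Function.Definitions using (Injective; Surjective)

Word : ℕ → Set
Word n = List (Fin n)

Lang : ℕ → Set₁
Lang n = Word n → Set

record LiteralAntimorphism {n : ℕ} (θ : Word n → Word n) : Set where
  field
    injective  : Injective _≡_ _≡_ θ
    surjective : Surjective _≡_ _≡_ θ
    letters    : ∀ (a : Fin n) → ∃[ b ] θ [ a ] ≡ [ b ]
    empty      : θ [] ≡ []
    anti       : ∀ (x y : Word n) → θ (x ++ y) ≡ θ y ++ θ x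

θ₀ : ∀ {n} → Word n → Word n
θ₀ = reverse

Involutive : ∀ {n} → (Word n → Word n) → Set
Involutive θ = ∀ w → θ (θ w) ≡ w

Invariant : ∀ {n} → (Word n → Word n) → Lang n → Set
Invariant {n} θ X =
  (∀ w → X w → X (θ w)) × (∀ w → X w → ∃[ v ] (X v × θ v ≡ w))

IsCode : ∀ {n} → Lang n → Set
IsCode {n} X = ∀ (xs ys : List (Word n)) → All X xs → All X ys →
  concat xs ≡ concat ys → xs ≡ ys

Star : ∀ {n} → Lang n → Lang n
Star {n} X w = ∃[ xs ] (All X xs × concat xs ≡ w)

Factors : ∀ {n} → Lang n → Lang n
Factors {n} S w = ∃[ u ] ∃[ v ] ∃[ s ] (S s × u ++ w ++ v ≡ s)

Complete : ∀ {n} → Lang n → Set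
Complete {n} X = ∀ (w : Word n) → Factors (Star X) w

record DFA (n : ℕ) : Set where
  field
    k      : ℕ
    start  : Fin k
    δ      : Fin k → Fin n → Fin k
    final  : Fin k → Bool

  run : Fin k → Word n → Fin k
  run = foldl δ

  accepts : Word n → Set
  accepts w = final (run start w) ≡ true

Regular : ∀ {n} → Lang n → Set
Regular {n} X = ∃[ M ] (∀ (w : Word n) → (X w → DFA.accepts M w) × (DFA.accepts M w → X w))

-- Since θ ≠ θ₀ some letter a is moved, and then b = θ(a) ≠ a with θ(b) = a. For y ∉ F(X*) the word
-- z = aᴺ b y θ(y) a bᴺ is unbordered, fixed by θ, and still not in F(X*). The Ehrenfeucht–Rozenberg
-- completion Y = X ∪ (zU)*z, U = A* ∖ (X* ∪ A*zA*), is then a code, because in a product of Y-words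
-- the occurrences of the unbordered z are exactly the z's inside its (zU)*z-factors; it is complete
-- since zwz ∈ Y* for every w; and it is θ-invariant because θ fixes z and preserves U.
-- Regularity makes X* and F(X*) decidable, so y can be chosen canonically, as the first non-factor
-- found by a bounded search, rather than extracted from ¬ Complete X, which yields no witness.
module Submission where

open import Defs
open import Data.Nat using (ℕ; zero; suc; _+_; _∸_; _≤_; _<_; z≤n; s≤s; _<?_)
open import Data.Nat.Properties
  using (≤-refl; ≤-trans; ≤-<-trans; <-irrefl; <⇒≤; ≤-pred; m≤m+n; m≤n+m; ≮⇒≥; <-cmp;
         m≤n⇒m<n∨m≡n; m+[n∸m]≡n; m≤n⇒m⊓n≡m; +-monoˡ-<)
open import Data.Nat.Induction using (<-wellFounded)
open import Data.Fin using (Fin; toℕ)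
open import Data.Fin.Properties using (any?; pigeonhole; toℕ<n; ¬∀⟶∃¬) renaming (_≟_ to _≟ᶠ_)
open import Data.Bool using (true)
open import Data.Bool.Properties using () renaming (_≟_ to _≟ᵇ_)
open import Data.List using (List; []; _∷_; [_]; _++_; concat; length; replicate; reverse; foldl; take; drop)
open import Data.List.Properties
  using (++-assoc; ++-identityʳ; ++-cancelˡ; ++-conicalˡ; ++-conicalʳ; ∷-injectiveˡ; ∷-injectiveʳ;
         length-++; length-take; length-drop; take++drop≡id; length-replicate; concat-++; foldl-++; unfold-reverse;
         ≡-dec; ++-monoid)
open import Data.List.Relation.Unary.All using (All; []; _∷_) renaming (map to mapAll)
open import Data.List.Relation.Unary.All.Properties using (++⁺; ++⁻ˡ; ++⁻ʳ; replicate⁺)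
open import Data.Maybe using (Maybe; just; nothing)
open import Data.Product using (_×_; _,_; ∃; ∃-syntax; proj₁; proj₂)
open import Data.Sum using (_⊎_; inj₁; inj₂; [_,_]′; reduce)
open import Data.Empty using (⊥; ⊥-elim)
open import Induction.WellFounded using (module All)
open import Relation.Binary.Construct.On using (wellFounded)
open import Relation.Binary.Definitions using (DecidableEquality; tri<; tri≈; tri>)
open import Relation.Binary.PropositionalEquality
  using (_≡_; _≢_; refl; sym; trans; cong; cong₂; subst; subst₂; module ≡-Reasoning)
open import Relation.Nullary using (¬_; Dec; yes; no)
open import Relation.Nullary.Decidable using (_×-dec_; _⊎-dec_; map′; ¬?)
open import Tactic.MonoidSolver using (solve)

module _ {A : Set} where

  levi : ∀ (a b c d : List A) → a ++ b ≡ c ++ d →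
    (∃[ r ] (c ≡ a ++ r × b ≡ r ++ d)) ⊎ (∃[ r ] (a ≡ c ++ r × d ≡ r ++ b))
  levi [] b c d eq = inj₁ (c , refl , eq)
  levi (x ∷ a) b [] d eq = inj₂ (x ∷ a , refl , sym eq)
  levi (x ∷ a) b (y ∷ c) d eq with ∷-injectiveˡ eq | levi a b c d (∷-injectiveʳ eq)
  ... | refl | inj₁ (r , c≡ar , b≡rd) = inj₁ (r , cong (x ∷_) c≡ar , b≡rd)
  ... | refl | inj₂ (r , a≡cr , d≡rb) = inj₂ (r , cong (x ∷_) a≡cr , d≡rb)

  length-induction : ∀ {P : List A → Set} →
    (∀ w → (∀ v → length v < length w → P v) → P w) → ∀ w → P w
  length-induction {P} step =
    All.wfRec (wellFounded length <-wellFounded) _ P (λ w rec → step w (λ v → rec))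

  length-<-++ : ∀ (r s : List A) → r ≢ [] → length s < length (r ++ s)
  length-<-++ [] s r≢[] = ⊥-elim (r≢[] refl)
  length-<-++ (x ∷ r) s _ = s≤s (subst (length s ≤_) (sym (length-++ r)) (m≤n+m (length s) (length r)))

  length-<-++-++ : ∀ (p z q : List A) → z ≢ [] → length q < length (p ++ z ++ q)
  length-<-++-++ p z q z≢[] = subst (length q <_) (cong length (++-assoc p z q))
    (length-<-++ (p ++ z) q (λ pz≡[] → z≢[] (++-conicalʳ p z pz≡[])))

  no-self-infix : ∀ r z s → r ≢ [] → z ≢ r ++ z ++ s
  no-self-infix r z s r≢[] eq = <-irrefl refl (≤-<-trans z≤zs zs<z)
    where
    z≤zs : length z ≤ length (z ++ s)
    z≤zs = subst (length z ≤_) (sym (length-++ z)) (m≤m+n (length z) (length s))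
    zs<z : length (z ++ s) < length z
    zs<z = subst (length (z ++ s) <_) (cong length (sym eq)) (length-<-++ r (z ++ s) r≢[])

  ++-assoc³ : ∀ (a b c d : List A) → (a ++ b ++ c) ++ d ≡ a ++ b ++ c ++ d
  ++-assoc³ a b c d = trans (++-assoc a (b ++ c) d) (cong (a ++_) (++-assoc b c d))

  concat-++-∷ : ∀ (xs : List (List A)) w r → concat (xs ++ w ∷ r) ≡ concat xs ++ w ++ concat r
  concat-++-∷ xs w r = sym (concat-++ xs (w ∷ r))

  Avoids : List A → List A → Set
  Avoids z s = ∀ p q → s ≢ p ++ z ++ q

  avoids-suffix : ∀ {z} p {s} → Avoids z (p ++ s) → Avoids z s
  avoids-suffix p avoids a b eq = avoids (p ++ a) b (trans (cong (p ++_) eq) (sym (++-assoc p a _)))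

  []-avoids : ∀ {z} → z ≢ [] → Avoids z []
  []-avoids z≢[] p q eq = z≢[] (++-conicalˡ _ q (++-conicalʳ p _ (sym eq)))

  Unbordered : List A → Set
  Unbordered z = ∀ r t s → r ≢ [] → t ≢ [] → z ≡ r ++ t → z ≢ t ++ s

  module _ {z : List A} (unbordered : Unbordered z) where

    occurrence-after-gap : ∀ r q q' → Avoids z r → r ≢ [] → z ++ q ≢ r ++ z ++ q'
    occurrence-after-gap r q q' r-avoids r≢[] eq with levi z q r (z ++ q') eq
    ... | inj₁ (s , r≡zs , _) = r-avoids [] s r≡zs
    ... | inj₂ (t , z≡rt , zq'≡tq) with levi z q' t q zq'≡tq
    ...   | inj₁ (s , t≡zs , _) = no-self-infix r z s r≢[] (trans z≡rt (cong (r ++_) t≡zs))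
    ...   | inj₂ (s , z≡ts , _) with t
    ...     | [] = r-avoids [] [] (sym (trans (++-identityʳ z) (trans z≡rt (++-identityʳ r))))
    ...     | x ∷ t' = unbordered r (x ∷ t') s r≢[] (λ ()) z≡rt z≡ts

    first-occurrence-unique : ∀ p p' q q' → Avoids z p → Avoids z p' →
      p ++ z ++ q ≡ p' ++ z ++ q' → p ≡ p'
    first-occurrence-unique p p' q q' p-avoids p'-avoids eq with levi p (z ++ q) p' (z ++ q') eq
    ... | inj₁ ([] , p'≡p , _) = sym (trans p'≡p (++-identityʳ p))
    ... | inj₁ (x ∷ r , p'≡pr , zq≡rzq') = ⊥-elim (occurrence-after-gap (x ∷ r) q q'
            (avoids-suffix p (subst (Avoids z) p'≡pr p'-avoids)) (λ ()) zq≡rzq')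
    ... | inj₂ ([] , p≡p' , _) = trans p≡p' (++-identityʳ p')
    ... | inj₂ (x ∷ r , p≡p'r , zq'≡rzq) = ⊥-elim (occurrence-after-gap (x ∷ r) q' q
            (avoids-suffix p' (subst (Avoids z) p≡p'r p-avoids)) (λ ()) zq'≡rzq)

module _ {A : Set} (_≟_ : DecidableEquality A) where

  prefix-of? : ∀ (z w : List A) → Dec (∃[ q ] (w ≡ z ++ q))
  prefix-of? [] w = yes (w , refl)
  prefix-of? (x ∷ z) [] = no λ ()
  prefix-of? (x ∷ z) (y ∷ w) with x ≟ y | prefix-of? z w
  ... | yes refl | yes (q , w≡zq) = yes (q , cong (x ∷_) w≡zq)
  ... | yes refl | no ¬prefix = no λ (q , eq) → ¬prefix (q , ∷-injectiveʳ eq)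
  ... | no x≢y | _ = no λ (q , eq) → x≢y (sym (∷-injectiveˡ eq))

  first-occurrence? : ∀ {z} → z ≢ [] → ∀ w →
    Avoids z w ⊎ ∃[ p ] ∃[ q ] (w ≡ p ++ z ++ q × Avoids z p)
  first-occurrence? z≢[] [] = inj₁ ([]-avoids z≢[])
  first-occurrence? {z} z≢[] (a ∷ w) with prefix-of? z (a ∷ w)
  ... | yes (q , aw≡zq) = inj₂ ([] , q , aw≡zq , []-avoids z≢[])
  ... | no not-prefix with first-occurrence? z≢[] w
  ...   | inj₁ w-avoids = inj₁ λ
          { [] q aw≡zq → not-prefix (q , aw≡zq)
          ; (_ ∷ p) q aw≡pzq → w-avoids p q (∷-injectiveʳ aw≡pzq) }
  ...   | inj₂ (p , q , w≡pzq , p-avoids) = inj₂ (a ∷ p , q , cong (a ∷_) w≡pzq , λ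
          { [] q' ap≡zq' → not-prefix (q' ++ z ++ q , trans (cong (a ∷_) w≡pzq)
              (trans (cong (_++ z ++ q) ap≡zq') (++-assoc z q' _)))
          ; (_ ∷ p') q' ap≡p'zq' → p-avoids p' q' (∷-injectiveʳ ap≡p'zq') })

module _ {A : Set} {x y : A} (x≢y : x ≢ y) where

  ¬All≡-++-∷ : ∀ s t → ¬ All (_≡ x) (s ++ y ∷ t)
  ¬All≡-++-∷ s t all-x with ++⁻ʳ s all-x
  ... | y≡x ∷ _ = x≢y (sym y≡x)

  replicate-≢-++-∷ : ∀ N s t → replicate N x ≢ s ++ y ∷ t
  replicate-≢-++-∷ N s t eq = ¬All≡-++-∷ s t (subst (All (_≡ x)) eq (replicate⁺ N refl))

  ++-∷-≢-replicate-++ : ∀ N s t u → length s < N → s ++ y ∷ u ≢ replicate N x ++ t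
  ++-∷-≢-replicate-++ (suc N) [] t u _ eq = x≢y (sym (∷-injectiveˡ eq))
  ++-∷-≢-replicate-++ (suc N) (_ ∷ s) t u (s≤s |s|<N) eq =
    ++-∷-≢-replicate-++ N s t u |s|<N (∷-injectiveʳ eq)

bracket : ∀ {A : Set} → A → A → List A → List A
bracket a b c = replicate (length m) a ++ m ++ replicate (length m) b
  where m = b ∷ c ++ [ a ]

bracket-infix : ∀ {A : Set} (a b : A) c → ∃[ u ] ∃[ v ] (u ++ c ++ v ≡ bracket a b c)
bracket-infix {A} a b c =
  replicate N a ++ [ b ] , [ a ] ++ replicate N b , reassoc (replicate N a) [ b ] [ a ] (replicate N b)
  where
  N = length (b ∷ c ++ [ a ])
  reassoc : ∀ s t u v → (s ++ t) ++ c ++ u ++ v ≡ s ++ (t ++ c ++ u) ++ v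
  reassoc s t u v = solve (++-monoid A)

module _ {A : Set} {a b : A} (a≢b : a ≢ b) (c : List A) where

  private
    m : List A
    m = b ∷ c ++ [ a ]
    N : ℕ
    N = length m
    aᴺ bᴺ : List A
    aᴺ = replicate N a
    bᴺ = replicate N b

    b≢a : b ≢ a
    b≢a b≡a = a≢b (sym b≡a)

    all-a-not-suffix : ∀ r t → t ≢ [] → bracket a b c ≡ r ++ t → ¬ All (_≡ a) t
    all-a-not-suffix r t t≢[] z≡rt all-a
      with levi (aᴺ ++ m) bᴺ r t (trans (++-assoc aᴺ m bᴺ) z≡rt)
    ... | inj₂ (s , _ , t≡sbᴺ) = ¬All≡-++-∷ a≢b s _ (subst (All (_≡ a)) t≡sbᴺ all-a)
    ... | inj₁ (s , _ , bᴺ≡st) with t | all-a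
    ...   | [] | _ = t≢[] refl
    ...   | _ ∷ t' | refl ∷ _ = replicate-≢-++-∷ b≢a N s t' bᴺ≡st

  -- A border t of aᴺ m bᴺ is either a block of a's, which cannot end the word, or begins with aᴺ,
  -- which occurs only at the start of the word.
  bracket-unbordered : Unbordered (bracket a b c)
  bracket-unbordered r t s r≢[] t≢[] z≡rt z≡ts with levi aᴺ (m ++ bᴺ) t s z≡ts
  ... | inj₂ (t' , aᴺ≡tt' , _) =
    all-a-not-suffix r t t≢[] z≡rt (++⁻ˡ t (subst (All (_≡ a)) aᴺ≡tt' (replicate⁺ N refl)))
  ... | inj₁ (t₂ , t≡aᴺt₂ , _) with levi aᴺ (m ++ bᴺ) r (aᴺ ++ t₂) (trans z≡rt (cong (r ++_) t≡aᴺt₂))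
  ...   | inj₂ (s' , aᴺ≡rs' , aᴺt₂≡s'mbᴺ) =
    ++-∷-≢-replicate-++ a≢b N s' t₂ _ |s'|<N (sym aᴺt₂≡s'mbᴺ)
    where
    |s'|<N : length s' < N
    |s'|<N = subst (length s' <_) (trans (cong length (sym aᴺ≡rs')) (length-replicate N))
               (length-<-++ r s' r≢[])
  ...   | inj₁ (r₂ , _ , mbᴺ≡r₂aᴺt₂) with levi m bᴺ r₂ (aᴺ ++ t₂) mbᴺ≡r₂aᴺt₂
  ...     | inj₁ (s' , _ , bᴺ≡s'aᴺt₂) = replicate-≢-++-∷ b≢a N s' _ bᴺ≡s'aᴺt₂
  ...     | inj₂ (s' , m≡r₂s' , aᴺt₂≡s'bᴺ) with r₂
  ...       | [] = ++-∷-≢-replicate-++ a≢b N [] t₂ _ (s≤s z≤n)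
                     (trans (cong (_++ bᴺ) m≡r₂s') (sym aᴺt₂≡s'bᴺ))
  ...       | x ∷ r₂' = ++-∷-≢-replicate-++ a≢b N s' t₂ _
                          (subst (length s' <_) (cong length (sym m≡r₂s')) (length-<-++ (x ∷ r₂') s' (λ ())))
                          (sym aᴺt₂≡s'bᴺ)

module Completion {n : ℕ} (X : Lang n) (z : Word n) where

  U : Lang n
  U u = Avoids z u × ¬ Star X u

  data W : Lang n where
    z∈W : W z
    zuw∈W : ∀ {u w} → U u → W w → W (z ++ u ++ w)

  Y : Lang n
  Y w = X w ⊎ W w

  W-starts-with-z : ∀ {w} → W w → ∀ s → ∃[ s' ] (w ++ s ≡ z ++ s')
  W-starts-with-z z∈W s = s , refl
  W-starts-with-z (zuw∈W {u} {w} _ _) s = u ++ w ++ s , ++-assoc³ z u w s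

  data Y-view : List (Word n) → Set where
    all-X : ∀ {ys} → All X ys → Y-view ys
    first-W : ∀ xs {w} r → All X xs → W w → All Y r → Y-view (xs ++ w ∷ r)

  y-view : ∀ {ys} → All Y ys → Y-view ys
  y-view [] = all-X []
  y-view (inj₂ w∈W ∷ r∈Y*) = first-W [] _ [] w∈W r∈Y*
  y-view (inj₁ x∈X ∷ ys∈Y*) with y-view ys∈Y*
  ... | all-X ys∈X* = all-X (x∈X ∷ ys∈X*)
  ... | first-W xs r xs∈X* w∈W r∈Y* = first-W (_ ∷ xs) r (x∈X ∷ xs∈X*) w∈W r∈Y*

  module Code (X-code : IsCode X) (z-unbordered : Unbordered z)
              (X*-avoids-z : ∀ xs → All X xs → Avoids z (concat xs)) where

    open ≡-Reasoning

    X*-≢-X*-then-W : ∀ {ys xs w} r → All X ys → All X xs → W w → concat ys ≢ concat xs ++ w ++ concat r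
    X*-≢-X*-then-W {ys} {xs} r ys∈X* _ w∈W eq with W-starts-with-z w∈W (concat r)
    ... | s , wr≡zs = avoids-suffix (concat xs) (subst (Avoids z) eq (X*-avoids-z ys ys∈X*)) [] s wr≡zs

    Y*-≢-U-then-W : ∀ {u w r r'} → U u → W w → All Y r → All Y r' → concat r ≢ u ++ w ++ concat r'
    Y*-≢-U-then-W {u} {w} {r} {r'} (u-avoids , u∉X*) w∈W r∈Y* _ eq
      with W-starts-with-z w∈W (concat r') | y-view r∈Y*
    ... | s , wr'≡zs | all-X r∈X* = X*-avoids-z r r∈X* u s (trans eq (cong (u ++_) wr'≡zs))
    ... | s , wr'≡zs | first-W xs {w₂} r₂ xs∈X* w₂∈W _ with W-starts-with-z w₂∈W (concat r₂)
    ...   | s₂ , w₂r₂≡zs₂ = u∉X* (xs , xs∈X* , sym u≡xs)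
      where
      u≡xs : u ≡ concat xs
      u≡xs = first-occurrence-unique z-unbordered u (concat xs) s s₂ u-avoids (X*-avoids-z xs xs∈X*) (begin
        u ++ z ++ s                  ≡⟨ cong (u ++_) wr'≡zs ⟨
        u ++ w ++ concat r'          ≡⟨ eq ⟨
        concat (xs ++ w₂ ∷ r₂)       ≡⟨ concat-++-∷ xs w₂ r₂ ⟩
        concat xs ++ w₂ ++ concat r₂ ≡⟨ cong (concat xs ++_) w₂r₂≡zs₂ ⟩
        concat xs ++ z ++ s₂         ∎)

    W-prefix-unique : ∀ {w w' r r'} → W w → W w' → All Y r → All Y r' →
      w ++ concat r ≡ w' ++ concat r' → w ≡ w'
    W-prefix-unique z∈W z∈W _ _ _ = refl
    W-prefix-unique z∈W (zuw∈W {u'} {w'} u'∈U w'∈W) r∈Y* r'∈Y* eq =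
      ⊥-elim (Y*-≢-U-then-W u'∈U w'∈W r∈Y* r'∈Y* (++-cancelˡ z _ _ (trans eq (++-assoc³ z u' w' _))))
    W-prefix-unique (zuw∈W {u} {w} u∈U w∈W) z∈W r∈Y* r'∈Y* eq =
      ⊥-elim (Y*-≢-U-then-W u∈U w∈W r'∈Y* r∈Y* (++-cancelˡ z _ _ (trans (sym eq) (++-assoc³ z u w _))))
    W-prefix-unique {r = r} {r'} (zuw∈W {u} {w} u∈U w∈W) (zuw∈W {u'} {w'} u'∈U w'∈W) r∈Y* r'∈Y* eq
      with W-starts-with-z w∈W (concat r) | W-starts-with-z w'∈W (concat r')
    ... | s , wr≡zs | s' , w'r'≡zs' = cong₂ (λ u w → z ++ u ++ w) u≡u' w≡w'
      where
      uwr≡u'w'r' : u ++ w ++ concat r ≡ u' ++ w' ++ concat r'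
      uwr≡u'w'r' = ++-cancelˡ z _ _ (trans (sym (++-assoc³ z u w _)) (trans eq (++-assoc³ z u' w' _)))
      u≡u' : u ≡ u'
      u≡u' = first-occurrence-unique z-unbordered u u' s s' (proj₁ u∈U) (proj₁ u'∈U) (begin
        u ++ z ++ s          ≡⟨ cong (u ++_) wr≡zs ⟨
        u ++ w ++ concat r   ≡⟨ uwr≡u'w'r' ⟩
        u' ++ w' ++ concat r' ≡⟨ cong (u' ++_) w'r'≡zs' ⟩
        u' ++ z ++ s'        ∎)
      w≡w' : w ≡ w'
      w≡w' = W-prefix-unique w∈W w'∈W r∈Y* r'∈Y*
               (++-cancelˡ u' _ _ (trans (cong (_++ w ++ concat r) (sym u≡u')) uwr≡u'w'r'))

    Factorises-uniquely : List (Word n) → Set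
    Factorises-uniquely ys = ∀ ys' → All Y ys → All Y ys' → concat ys ≡ concat ys' → ys ≡ ys'

    Y-code : IsCode Y
    Y-code = length-induction step
      where
      step : ∀ ys → (∀ v → length v < length ys → Factorises-uniquely v) → Factorises-uniquely ys
      step ys IH ys' ys∈Y* ys'∈Y* eq with y-view ys∈Y* | y-view ys'∈Y*
      ... | all-X ys∈X* | all-X ys'∈X* = X-code ys ys' ys∈X* ys'∈X* eq
      ... | all-X ys∈X* | first-W xs' r' xs'∈X* w'∈W _ =
        ⊥-elim (X*-≢-X*-then-W r' ys∈X* xs'∈X* w'∈W (trans eq (concat-++-∷ xs' _ r')))
      ... | first-W xs r xs∈X* w∈W _ | all-X ys'∈X* =
        ⊥-elim (X*-≢-X*-then-W r ys'∈X* xs∈X* w∈W (trans (sym eq) (concat-++-∷ xs _ r)))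
      ... | first-W xs {w} r xs∈X* w∈W r∈Y* | first-W xs' {w'} r' xs'∈X* w'∈W r'∈Y*
        with W-starts-with-z w∈W (concat r) | W-starts-with-z w'∈W (concat r')
      ...   | s , wr≡zs | s' , w'r'≡zs' = cong₂ _++_ xs≡xs' (cong₂ _∷_ w≡w' r≡r')
        where
        xs-w-r≡xs'-w'-r' : concat xs ++ w ++ concat r ≡ concat xs' ++ w' ++ concat r'
        xs-w-r≡xs'-w'-r' = trans (sym (concat-++-∷ xs w r)) (trans eq (concat-++-∷ xs' w' r'))
        xs≡xs' : xs ≡ xs'
        xs≡xs' = X-code xs xs' xs∈X* xs'∈X*
          (first-occurrence-unique z-unbordered (concat xs) (concat xs') s s'
            (X*-avoids-z xs xs∈X*) (X*-avoids-z xs' xs'∈X*) (begin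
              concat xs ++ z ++ s           ≡⟨ cong (concat xs ++_) wr≡zs ⟨
              concat xs ++ w ++ concat r    ≡⟨ xs-w-r≡xs'-w'-r' ⟩
              concat xs' ++ w' ++ concat r' ≡⟨ cong (concat xs' ++_) w'r'≡zs' ⟩
              concat xs' ++ z ++ s'         ∎))
        wr≡w'r' : w ++ concat r ≡ w' ++ concat r'
        wr≡w'r' = ++-cancelˡ (concat xs) _ _
          (trans xs-w-r≡xs'-w'-r' (cong (λ l → concat l ++ w' ++ concat r') (sym xs≡xs')))
        w≡w' : w ≡ w'
        w≡w' = W-prefix-unique w∈W w'∈W r∈Y* r'∈Y* wr≡w'r'
        r≡r' : r ≡ r'
        r≡r' = IH r (subst (length r <_) (sym (length-++ xs)) (m≤n+m (suc (length r)) (length xs)))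
                 r' r∈Y* r'∈Y* (++-cancelˡ w _ _ (trans wr≡w'r' (cong (_++ concat r') (sym w≡w'))))

  module Completeness (z≢[] : z ≢ []) (X*? : ∀ w → Dec (Star X w)) where

    WY* : Lang n
    WY* s = ∃[ e ] ∃[ ys ] (W e × All Y ys × e ++ concat ys ≡ s)

    zwz-∈-WY* : ∀ w → WY* (z ++ w ++ z)
    zwz-∈-WY* = length-induction step
      where
      X*-⊆-Y* : ∀ {xs} → All X xs → All Y xs
      X*-⊆-Y* = mapAll inj₁

      step : ∀ w → (∀ v → length v < length w → WY* (z ++ v ++ z)) → WY* (z ++ w ++ z)
      step w IH with first-occurrence? _≟ᶠ_ z≢[] w
      step w IH | inj₁ w-avoids with X*? w
      ... | yes (xs , xs∈X* , refl) =
        z , xs ++ [ z ] , z∈W , ++⁺ (X*-⊆-Y* xs∈X*) (inj₂ z∈W ∷ []) ,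
        cong (z ++_) (trans (concat-++-∷ xs z []) (cong (concat xs ++_) (++-identityʳ z)))
      ... | no w∉X* = z ++ w ++ z , [] , zuw∈W (w-avoids , w∉X*) z∈W , [] , ++-identityʳ _
      step w IH | inj₂ (p , q , refl , p-avoids) with IH q (length-<-++-++ p z q z≢[]) | X*? p
      ... | e , ys , e∈W , ys∈Y* , e-ys≡zqz | yes (xs , xs∈X* , refl) =
        z , xs ++ e ∷ ys , z∈W , ++⁺ (X*-⊆-Y* xs∈X*) (inj₂ e∈W ∷ ys∈Y*) , (begin
          z ++ concat (xs ++ e ∷ ys)       ≡⟨ cong (z ++_) (concat-++-∷ xs e ys) ⟩
          z ++ concat xs ++ e ++ concat ys ≡⟨ cong (λ t → z ++ concat xs ++ t) e-ys≡zqz ⟩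
          z ++ concat xs ++ z ++ q ++ z    ≡⟨ reassoc (concat xs) ⟩
          z ++ (concat xs ++ z ++ q) ++ z  ∎)
        where
        open ≡-Reasoning
        reassoc : ∀ p → z ++ p ++ z ++ q ++ z ≡ z ++ (p ++ z ++ q) ++ z
        reassoc p = solve (++-monoid (Fin n))
      ... | e , ys , e∈W , ys∈Y* , e-ys≡zqz | no p∉X* =
        z ++ p ++ e , ys , zuw∈W (p-avoids , p∉X*) e∈W , ys∈Y* , (begin
          (z ++ p ++ e) ++ concat ys   ≡⟨ ++-assoc³ z p e (concat ys) ⟩
          z ++ p ++ e ++ concat ys     ≡⟨ cong (λ t → z ++ p ++ t) e-ys≡zqz ⟩
          z ++ p ++ z ++ q ++ z        ≡⟨ reassoc ⟩
          z ++ (p ++ z ++ q) ++ z      ∎)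
        where
        open ≡-Reasoning
        reassoc : z ++ p ++ z ++ q ++ z ≡ z ++ (p ++ z ++ q) ++ z
        reassoc = solve (++-monoid (Fin n))

    Y-complete : Complete Y
    Y-complete w with zwz-∈-WY* w
    ... | e , ys , e∈W , ys∈Y* , e-ys≡zwz =
      z , z , e ++ concat ys , (e ∷ ys , inj₂ e∈W ∷ ys∈Y* , refl) , sym e-ys≡zwz

  module Invariance {θ : Word n → Word n} (θ-antimorphism : LiteralAntimorphism θ) (θ-involutive : Involutive θ)
                    (θz≡z : θ z ≡ z) (θX⊆X : ∀ w → X w → X (θ w)) where

    open LiteralAntimorphism θ-antimorphism using (anti; empty)

    θ-X* : ∀ {w} → Star X w → Star X (θ w)
    θ-X* ([] , [] , refl) = [] , [] , sym empty
    θ-X* (x ∷ xs , x∈X ∷ xs∈X* , refl) with θ-X* (xs , xs∈X* , refl)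
    ... | ys , ys∈X* , ys≡θxs = ys ++ [ θ x ] , ++⁺ ys∈X* (θX⊆X x x∈X ∷ []) , (begin
      concat (ys ++ [ θ x ])        ≡⟨ concat-++-∷ ys (θ x) [] ⟩
      concat ys ++ θ x ++ []        ≡⟨ cong₂ _++_ ys≡θxs (++-identityʳ (θ x)) ⟩
      θ (concat xs) ++ θ x          ≡⟨ anti x (concat xs) ⟨
      θ (x ++ concat xs)            ∎)
      where open ≡-Reasoning

    θ-avoids : ∀ {u} → Avoids z u → Avoids z (θ u)
    θ-avoids {u} u-avoids p q θu≡pzq = u-avoids (θ q) (θ p) (begin
      u                        ≡⟨ θ-involutive u ⟨
      θ (θ u)                  ≡⟨ cong θ θu≡pzq ⟩
      θ (p ++ z ++ q)          ≡⟨ anti p (z ++ q) ⟩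
      θ (z ++ q) ++ θ p        ≡⟨ cong (_++ θ p) (anti z q) ⟩
      (θ q ++ θ z) ++ θ p      ≡⟨ cong (λ t → (θ q ++ t) ++ θ p) θz≡z ⟩
      (θ q ++ z) ++ θ p        ≡⟨ ++-assoc (θ q) z (θ p) ⟩
      θ q ++ z ++ θ p          ∎)
      where open ≡-Reasoning

    θ-U : ∀ {u} → U u → U (θ u)
    θ-U {u} (u-avoids , u∉X*) =
      θ-avoids u-avoids , λ θu∈X* → u∉X* (subst (Star X) (θ-involutive u) (θ-X* θu∈X*))

    W-snoc : ∀ {w u} → W w → U u → W (w ++ u ++ z)
    W-snoc z∈W u∈U = zuw∈W u∈U z∈W
    W-snoc {u = u} (zuw∈W {u'} {w} u'∈U w∈W) u∈U =
      subst W (sym (++-assoc³ z u' w (u ++ z))) (zuw∈W u'∈U (W-snoc w∈W u∈U))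

    θ-W : ∀ {w} → W w → W (θ w)
    θ-W z∈W = subst W (sym θz≡z) z∈W
    θ-W (zuw∈W {u} {w} u∈U w∈W) = subst W (sym θzuw≡θw-θu-z) (W-snoc (θ-W w∈W) (θ-U u∈U))
      where
      open ≡-Reasoning
      θzuw≡θw-θu-z : θ (z ++ u ++ w) ≡ θ w ++ θ u ++ z
      θzuw≡θw-θu-z = begin
        θ (z ++ u ++ w)        ≡⟨ anti z (u ++ w) ⟩
        θ (u ++ w) ++ θ z      ≡⟨ cong₂ _++_ (anti u w) θz≡z ⟩
        (θ w ++ θ u) ++ z      ≡⟨ ++-assoc (θ w) (θ u) z ⟩
        θ w ++ θ u ++ z        ∎

any-shorter? : ∀ {n} {P : Word n → Set} → (∀ w → Dec (P w)) → ∀ L → Dec (∃[ w ] (length w < L × P w))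
any-shorter? P? zero = no λ { (_ , () , _) }
any-shorter? {P = P} P? (suc L) = map′ to from (P? [] ⊎-dec any? (λ a → any-shorter? (λ w → P? (a ∷ w)) L))
  where
  to : P [] ⊎ ∃ (λ a → ∃[ w ] (length w < L × P (a ∷ w))) → ∃[ w ] (length w < suc L × P w)
  to (inj₁ p) = [] , s≤s z≤n , p
  to (inj₂ (a , w , |w|<L , p)) = a ∷ w , s≤s |w|<L , p
  from : ∃[ w ] (length w < suc L × P w) → P [] ⊎ ∃ (λ a → ∃[ w ] (length w < L × P (a ∷ w)))
  from ([] , _ , p) = inj₁ p
  from (a ∷ w , s≤s |w|<L , p) = inj₂ (a , w , |w|<L , p)

module Automaton {n : ℕ} (M : DFA n) where

  open DFA M

  run-shorten : ∀ q u → k ≤ length u → ∃[ u' ] (length u' < length u × run q u' ≡ run q u)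
  -- Two of the k + 1 prefixes of u of length ≤ k reach the same state; cut out the loop between them.
  run-shorten q u k≤|u| with pigeonhole (s≤s k≤|u|) (λ i → run q (take (toℕ i) u))
  ... | i , j , i<j , same-state = take (toℕ i) u ++ drop (toℕ j) u , shorter , same-run
    where
    open ≡-Reasoning
    j≤|u| : toℕ j ≤ length u
    j≤|u| = ≤-pred (toℕ<n j)
    shorter : length (take (toℕ i) u ++ drop (toℕ j) u) < length u
    -- i + (|u| ∸ j) < j + (|u| ∸ j) = |u|
    shorter = subst₂ _<_
      (sym (trans (length-++ (take (toℕ i) u))
        (cong₂ _+_ (trans (length-take (toℕ i) u) (m≤n⇒m⊓n≡m (≤-trans (<⇒≤ i<j) j≤|u|)))
                   (length-drop (toℕ j) u))))
      (m+[n∸m]≡n j≤|u|)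
      (+-monoˡ-< (length u ∸ toℕ j) i<j)
    same-run : run q (take (toℕ i) u ++ drop (toℕ j) u) ≡ run q u
    same-run = begin
      run q (take (toℕ i) u ++ drop (toℕ j) u)         ≡⟨ foldl-++ δ q (take (toℕ i) u) _ ⟩
      foldl δ (run q (take (toℕ i) u)) (drop (toℕ j) u) ≡⟨ cong (λ s → foldl δ s (drop (toℕ j) u)) same-state ⟩
      foldl δ (run q (take (toℕ j) u)) (drop (toℕ j) u) ≡⟨ foldl-++ δ q (take (toℕ j) u) _ ⟨
      run q (take (toℕ j) u ++ drop (toℕ j) u)         ≡⟨ cong (run q) (take++drop≡id (toℕ j) u) ⟩
      run q u                                          ∎

  run-short : ∀ q u → ∃[ u' ] (length u' < k × run q u' ≡ run q u)
  run-short q = length-induction step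
    where
    step : ∀ u → (∀ v → length v < length u → ∃[ v' ] (length v' < k × run q v' ≡ run q v)) →
      ∃[ u' ] (length u' < k × run q u' ≡ run q u)
    step u IH with length u <? k
    ... | yes |u|<k = u , |u|<k , refl
    ... | no |u|≮k with run-shorten q u (≮⇒≥ |u|≮k)
    ...   | u' , |u'|<|u| , same-run with IH u' |u'|<|u|
    ...     | u'' , |u''|<k , same-run' = u'' , |u''|<k , trans same-run' same-run

  reachable? : ∀ q {P : Fin k → Set} → (∀ s → Dec (P s)) → Dec (∃[ u ] P (run q u))
  reachable? q {P} P? = map′ (λ (u , _ , p) → u , p) shorten (any-shorter? (λ u → P? (run q u)) k)
    where
    shorten : ∃[ u ] P (run q u) → ∃[ u ] (length u < k × P (run q u))
    shorten (u , p) with run-short q u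
    ... | u' , |u'|<k , same-run = u' , |u'|<k , subst P (sym same-run) p

  module Star (X : Lang n) (M-recognises-X : ∀ w → (X w → accepts w) × (accepts w → X w))
              (ε∉X : ¬ X []) where

    -- Runs of M extended by ε-jumps from final states back to start: an automaton for X*.
    data Path : Fin k → Word n → Fin k → Set where
      nil : ∀ {q} → Path q [] q
      step : ∀ {q a w r} → Path (δ q a) w r → Path q (a ∷ w) r
      jump : ∀ {q w r} → final q ≡ true → Path start w r → Path q w r

    run-path : ∀ q w → Path q w (run q w)
    run-path q [] = nil
    run-path q (a ∷ w) = step (run-path (δ q a) w)

    path-++ : ∀ {p u q w r} → Path p u q → Path q w r → Path p (u ++ w) r
    path-++ nil π = π
    path-++ (step π) π' = step (path-++ π π')
    path-++ (jump f π) π' = jump f (path-++ π π')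

    path-split : ∀ {p r} u {w} → Path p (u ++ w) r → ∃[ q ] (Path p u q × Path q w r)
    path-split [] π = _ , nil , π
    path-split (a ∷ u) (step π) with path-split u π
    ... | q , π₁ , π₂ = q , step π₁ , π₂
    path-split (a ∷ u) (jump f π) with path-split (a ∷ u) π
    ... | q , π₁ , π₂ = q , jump f π₁ , π₂

    X-++-X* : ∀ {x s} → X x → Star X s → Star X (x ++ s)
    X-++-X* x∈X (xs , xs∈X* , refl) = _ ∷ xs , x∈X ∷ xs∈X* , refl

    path-to-final : ∀ {q s r} → Path q s r → final r ≡ true →
      ∃[ x ] ∃[ s' ] (s ≡ x ++ s' × final (run q x) ≡ true × Star X s')
    path-to-final nil fr = [] , [] , refl , fr , [] , [] , refl
    path-to-final (step π) fr with path-to-final π fr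
    ... | x , s' , refl , f , s'∈X* = _ ∷ x , s' , refl , f , s'∈X*
    path-to-final (jump f π) fr with path-to-final π fr
    ... | x , s' , refl , f' , s'∈X* = [] , x ++ s' , refl , f , X-++-X* (proj₂ (M-recognises-X x) f') s'∈X*

    path→X* : ∀ {s f} → Path start s f → final f ≡ true → Star X s
    path→X* π ff with path-to-final π ff
    ... | x , s' , refl , f' , s'∈X* = X-++-X* (proj₂ (M-recognises-X x) f') s'∈X*

    X*→path : ∀ {s} → Star X s → s ≡ [] ⊎ ∃[ f ] (Path start s f × final f ≡ true)
    X*→path ([] , [] , refl) = inj₁ refl
    X*→path (x ∷ xs , x∈X ∷ xs∈X* , refl) with X*→path (xs , xs∈X* , refl)
    ... | inj₁ xs≡[] = inj₂ (run start x , subst (λ t → Path start t (run start x))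
            (sym (trans (cong (x ++_) xs≡[]) (++-identityʳ x))) (run-path start x) , proj₁ (M-recognises-X x) x∈X)
    ... | inj₂ (f , π , ff) = inj₂ (f , path-++ (run-path start x) (jump (proj₁ (M-recognises-X x) x∈X) π) , ff)

    -- A second consecutive jump would need start to be final, i.e. ε ∈ X.
    path? : ∀ q w r → Dec (Path q w r)
    path? q [] r with q ≟ᶠ r
    ... | yes refl = yes nil
    ... | no q≢r with final q ≟ᵇ true
    ...   | no ¬fq = no λ { nil → q≢r refl ; (jump f _) → ¬fq f }
    ...   | yes fq with start ≟ᶠ r
    ...     | yes refl = yes (jump fq nil)
    ...     | no start≢r = no λ { nil → q≢r refl ; (jump f nil) → start≢r refl
                                ; (jump f (jump f' _)) → ε∉X (proj₂ (M-recognises-X []) f') }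
    path? q (a ∷ w) r with path? (δ q a) w r
    ... | yes π = yes (step π)
    ... | no ¬π with final q ≟ᵇ true
    ...   | no ¬fq = no λ { (step π) → ¬π π ; (jump f _) → ¬fq f }
    ...   | yes fq with path? (δ start a) w r
    ...     | yes π = yes (jump fq (step π))
    ...     | no ¬π' = no λ { (step π) → ¬π π ; (jump f (step π)) → ¬π' π
                            ; (jump f (jump f' _)) → ε∉X (proj₂ (M-recognises-X []) f') }

    X*? : ∀ s → Dec (Star X s)
    X*? [] = yes ([] , [] , refl)
    X*? s@(_ ∷ _) = map′ (λ (f , π , ff) → path→X* π ff) accepting-path
                         (any? (λ f → path? start s f ×-dec (final f ≟ᵇ true)))
      where
      accepting-path : Star X s → ∃[ f ] (Path start s f × final f ≡ true)
      accepting-path s∈X* with X*→path s∈X*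
      ... | inj₂ π = π

    path-reachable : ∀ {p u q} → Path p u q → (∃[ u' ] (run p u' ≡ q)) ⊎ (∃[ u' ] (run start u' ≡ q))
    path-reachable nil = inj₁ ([] , refl)
    path-reachable (step π) with path-reachable π
    ... | inj₁ (u' , e) = inj₁ (_ ∷ u' , e)
    ... | inj₂ r = inj₂ r
    path-reachable (jump f π) with path-reachable π
    ... | inj₁ r = inj₂ r
    ... | inj₂ r = inj₂ r

    FactorPath : Word n → Set
    FactorPath w = w ≡ [] ⊎
      ∃[ q ] ∃[ q' ] ((∃[ u ] (run start u ≡ q)) × Path q w q' × (∃[ v ] (final (run q' v) ≡ true)))

    factorPath? : ∀ w → Dec (FactorPath w)
    factorPath? w = empty? w ⊎-dec any? (λ q → any? (λ q' →
      reachable? start (_≟ᶠ q) ×-dec (path? q w q' ×-dec reachable? q' (λ s → final s ≟ᵇ true))))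
      where
      empty? : ∀ (w : Word n) → Dec (w ≡ [])
      empty? [] = yes refl
      empty? (_ ∷ _) = no λ ()

    factorPath→factor : ∀ w → FactorPath w → Factors (Star X) w
    factorPath→factor w (inj₁ refl) = [] , [] , [] , ([] , [] , refl) , refl
    factorPath→factor w (inj₂ (q , q' , (u , refl) , π , (v , fv))) =
      u , v , (u ++ w) ++ v , path→X* (path-++ (path-++ (run-path start u) π) (run-path q' v)) fv ,
      sym (++-assoc u w v)

    factor→factorPath : ∀ w → Factors (Star X) w → FactorPath w
    factor→factorPath w (u , v , s , s∈X* , uwv≡s) with X*→path s∈X*
    ... | inj₁ refl = inj₁ (++-conicalˡ w v (++-conicalʳ u (w ++ v) uwv≡s))
    ... | inj₂ (f , π , ff) with path-split u (subst (λ t → Path start t f) (sym uwv≡s) π)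
    ...   | q , πᵤ , πwv with path-split w πwv
    ...     | q' , πw , πᵥ with path-to-final πᵥ ff
    ...       | v' , _ , _ , fv' , _ = inj₂ (q , q' , reduce (path-reachable πᵤ) , πw , v' , fv')

    factor-of-X*? : ∀ w → Dec (Factors (Star X) w)
    factor-of-X*? w = map′ (factorPath→factor w) (factor→factorPath w) (factorPath? w)

module Canonical {n : ℕ} {P : Word n → Set} (P? : ∀ w → Dec (P w)) where

  chosen : ℕ → Maybe (Word n)
  chosen L with any-shorter? P? L
  ... | yes (w , _) = just w
  ... | no _ = nothing

  chosen-sound : ∀ L {y} → chosen L ≡ just y → P y
  chosen-sound L eq with any-shorter? P? L
  chosen-sound L refl | yes (_ , _ , p) = p

  chosen-complete : ∀ L {w} → chosen L ≡ nothing → length w < L → ¬ P w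
  chosen-complete L eq |w|<L p with any-shorter? P? L
  ... | no none = none (_ , |w|<L , p)

  -- y is the witness found at the least bound L: a choice that depends on P alone.
  Canonical : Word n → Set
  Canonical y = ∃[ L ] (chosen L ≡ just y × ∀ L' → L' < L → chosen L' ≡ nothing)

  canonical-P : ∀ {y} → Canonical y → P y
  canonical-P (L , chosen-y , _) = chosen-sound L chosen-y

  canonical-unique : ∀ {y y'} → Canonical y → Canonical y' → y ≡ y'
  canonical-unique (L , chosen-y , below) (L' , chosen-y' , below') with <-cmp L L'
  ... | tri< L<L' _ _ with trans (sym chosen-y) (below' L L<L')
  ...   | ()
  canonical-unique (L , chosen-y , _) (L , chosen-y' , _) | tri≈ _ refl _
    with trans (sym chosen-y) chosen-y'
  ...   | refl = refl
  canonical-unique (L , _ , below) (L' , chosen-y' , _) | tri> _ _ L>L'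
    with trans (sym chosen-y') (below L' L>L')
  ...   | ()

  nothing-below-or-canonical : ∀ L → (∀ L' → L' < L → chosen L' ≡ nothing) ⊎ ∃ Canonical
  nothing-below-or-canonical zero = inj₁ λ _ ()
  nothing-below-or-canonical (suc L) with nothing-below-or-canonical L
  ... | inj₂ canonical = inj₂ canonical
  ... | inj₁ below with chosen L in chosen-L
  ...   | just y = inj₂ (y , L , chosen-L , below)
  ...   | nothing = inj₁ λ L' L'<1+L → [ below L' , (λ { refl → chosen-L }) ]′ (m≤n⇒m<n∨m≡n (≤-pred L'<1+L))

  canonical-exists : ∀ {w} → P w → ∃ Canonical
  canonical-exists {w} p with nothing-below-or-canonical (suc (suc (length w)))
  ... | inj₂ canonical = canonical
  ... | inj₁ below = ⊥-elim (chosen-complete (suc (length w)) (below _ ≤-refl) ≤-refl p)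

factor-of-star-mono : ∀ {n} {P Q : Lang n} → (∀ {w} → P w → Q w) →
  ∀ {w} → Factors (Star P) w → Factors (Star Q) w
factor-of-star-mono P⊆Q (u , v , s , (xs , xs∈P* , s≡xs) , uwv≡s) =
  u , v , s , (xs , mapAll P⊆Q xs∈P* , s≡xs) , uwv≡s

code-∌-ε : ∀ {n} {X : Lang n} → IsCode X → ¬ X []
code-∌-ε X-code ε∈X with X-code ([] ∷ []) ([] ∷ [] ∷ []) (ε∈X ∷ []) (ε∈X ∷ ε∈X ∷ []) refl
... | ()

module Antimorphism {n : ℕ} {θ : Word n → Word n} (θ-antimorphism : LiteralAntimorphism θ) where

  open LiteralAntimorphism θ-antimorphism

  fixes-letters⇒mirror : (∀ a → θ [ a ] ≡ [ a ]) → ∀ w → θ w ≡ θ₀ w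
  fixes-letters⇒mirror fixes [] = empty
  fixes-letters⇒mirror fixes (x ∷ w) = begin
    θ ([ x ] ++ w)     ≡⟨ anti [ x ] w ⟩
    θ w ++ θ [ x ]     ≡⟨ cong₂ _++_ (fixes-letters⇒mirror fixes w) (fixes x) ⟩
    reverse w ++ [ x ] ≡⟨ unfold-reverse x w ⟨
    reverse (x ∷ w)    ∎
    where open ≡-Reasoning

  θ-replicate : ∀ {x x'} → θ [ x ] ≡ [ x' ] → ∀ N → θ (replicate N x) ≡ replicate N x'
  θ-replicate θx≡x' zero = empty
  θ-replicate {x} {x'} θx≡x' (suc N) = begin
    θ ([ x ] ++ replicate N x)       ≡⟨ anti [ x ] (replicate N x) ⟩
    θ (replicate N x) ++ θ [ x ]     ≡⟨ cong₂ _++_ (θ-replicate θx≡x' N) θx≡x' ⟩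
    replicate N x' ++ [ x' ]         ≡⟨ replicate-++-[] N ⟩
    x' ∷ replicate N x'              ∎
    where
    open ≡-Reasoning
    replicate-++-[] : ∀ N → replicate N x' ++ [ x' ] ≡ x' ∷ replicate N x'
    replicate-++-[] zero = refl
    replicate-++-[] (suc N) = cong (x' ∷_) (replicate-++-[] N)

  θ-bracket : ∀ {a b c} → θ [ a ] ≡ [ b ] → θ [ b ] ≡ [ a ] → θ c ≡ c → θ (bracket a b c) ≡ bracket a b c
  θ-bracket {a} {b} {c} θa≡b θb≡a θc≡c = begin
    θ (aᴺ ++ m ++ bᴺ)            ≡⟨ anti aᴺ (m ++ bᴺ) ⟩
    θ (m ++ bᴺ) ++ θ aᴺ          ≡⟨ cong (_++ θ aᴺ) (anti m bᴺ) ⟩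
    (θ bᴺ ++ θ m) ++ θ aᴺ        ≡⟨ cong₂ (λ s t → (s ++ θ m) ++ t) (θ-replicate θb≡a N) (θ-replicate θa≡b N) ⟩
    (aᴺ ++ θ m) ++ bᴺ            ≡⟨ cong (λ t → (aᴺ ++ t) ++ bᴺ) θm≡m ⟩
    (aᴺ ++ m) ++ bᴺ              ≡⟨ ++-assoc aᴺ m bᴺ ⟩
    aᴺ ++ m ++ bᴺ                ∎
    where
    open ≡-Reasoning
    m = b ∷ c ++ [ a ]
    N = length m
    aᴺ = replicate N a
    bᴺ = replicate N b
    θm≡m : θ m ≡ m
    θm≡m = begin
      θ ([ b ] ++ c ++ [ a ])       ≡⟨ anti [ b ] (c ++ [ a ]) ⟩
      θ (c ++ [ a ]) ++ θ [ b ]     ≡⟨ cong (_++ θ [ b ]) (anti c [ a ]) ⟩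
      (θ [ a ] ++ θ c) ++ θ [ b ]   ≡⟨ cong₂ (λ s t → (s ++ t) ++ θ [ b ]) θa≡b θc≡c ⟩
      (b ∷ c) ++ θ [ b ]            ≡⟨ cong ((b ∷ c) ++_) θb≡a ⟩
      b ∷ c ++ [ a ]                ∎

  θ-++-θ : Involutive θ → ∀ y → θ (y ++ θ y) ≡ y ++ θ y
  θ-++-θ θ-involutive y = trans (anti y (θ y)) (cong (_++ θ y) (θ-involutive y))

module Extension {n : ℕ} {θ : Word n → Word n} (θ-antimorphism : LiteralAntimorphism θ)
                 (θ≢θ₀ : ¬ (∀ w → θ w ≡ θ₀ w)) (θ-involutive : Involutive θ)
                 {X : Lang n} (X-regular : Regular X) (X-invariant : Invariant θ X) (X-code : IsCode X) where

  open LiteralAntimorphism θ-antimorphism using (letters)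
  open Antimorphism θ-antimorphism
  open Automaton (proj₁ X-regular)
  open Star X (proj₂ X-regular) (code-∌-ε X-code)

  moved-letter : ∃[ a ] (θ [ a ] ≢ [ a ])
  moved-letter = ¬∀⟶∃¬ n _ (λ a → ≡-dec _≟ᶠ_ (θ [ a ]) [ a ]) (λ fixes → θ≢θ₀ (fixes-letters⇒mirror fixes))

  a b : Fin n
  a = proj₁ moved-letter
  b = proj₁ (letters a)

  θa≡b : θ [ a ] ≡ [ b ]
  θa≡b = proj₂ (letters a)

  θb≡a : θ [ b ] ≡ [ a ]
  θb≡a = trans (cong θ (sym θa≡b)) (θ-involutive [ a ])

  a≢b : a ≢ b
  a≢b a≡b = proj₂ moved-letter (trans θa≡b (cong [_] (sym a≡b)))

  z : Word n → Word n
  z y = bracket a b (y ++ θ y)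

  θz≡z : ∀ y → θ (z y) ≡ z y
  θz≡z y = θ-bracket θa≡b θb≡a (θ-++-θ θ-involutive y)

  NonFactor : Lang n
  NonFactor w = ¬ Factors (Star X) w

  X*-avoids-z : ∀ {y} → NonFactor y → ∀ xs → All X xs → Avoids (z y) (concat xs)
  X*-avoids-z {y} y∉F xs xs∈X* p q xs≡p-z-q with bracket-infix a b (y ++ θ y)
  ... | u , v , u-yθy-v≡z = y∉F (p ++ u , θ y ++ v ++ q , concat xs , (xs , xs∈X* , refl) , (begin
    (p ++ u) ++ y ++ θ y ++ v ++ q  ≡⟨ reassoc p u (θ y) v q ⟩
    p ++ (u ++ (y ++ θ y) ++ v) ++ q ≡⟨ cong (λ t → p ++ t ++ q) u-yθy-v≡z ⟩
    p ++ z y ++ q                   ≡⟨ xs≡p-z-q ⟨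
    concat xs                       ∎))
    where
    open ≡-Reasoning
    reassoc : ∀ p u t v q → (p ++ u) ++ y ++ t ++ v ++ q ≡ p ++ (u ++ (y ++ t) ++ v) ++ q
    reassoc p u t v q = solve (++-monoid (Fin n))

  open Canonical (λ w → ¬? (factor-of-X*? w))

  Y : Lang n
  Y w = X w ⊎ ∃[ y ] (Canonical y × Completion.W X (z y) w)

  module Y-at {y : Word n} (canonical : Canonical y) where

    open Completion X (z y) renaming (Y to Yᶻ)

    Y⊆Yᶻ : ∀ {w} → Y w → Yᶻ w
    Y⊆Yᶻ (inj₁ w∈X) = inj₁ w∈X
    Y⊆Yᶻ (inj₂ (_ , canonical' , w∈W)) with canonical-unique canonical' canonical
    ... | refl = inj₂ w∈W

    Yᶻ⊆Y : ∀ {w} → Yᶻ w → Y w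
    Yᶻ⊆Y (inj₁ w∈X) = inj₁ w∈X
    Yᶻ⊆Y (inj₂ w∈W) = inj₂ (y , canonical , w∈W)

    open Code X-code (bracket-unbordered a≢b (y ++ θ y)) (X*-avoids-z (canonical-P canonical))
      using () renaming (Y-code to Yᶻ-code)
    open Completeness (λ ()) X*? using () renaming (Y-complete to Yᶻ-complete)
    open Invariance θ-antimorphism θ-involutive (θz≡z y) (proj₁ X-invariant) public using (θ-W)

    Y-code : IsCode Y
    Y-code ys ys' ys∈Y* ys'∈Y* = Yᶻ-code ys ys' (mapAll Y⊆Yᶻ ys∈Y*) (mapAll Y⊆Yᶻ ys'∈Y*)

    Y-complete : Complete Y
    Y-complete w = factor-of-star-mono Yᶻ⊆Y (Yᶻ-complete w)

  Y*-X*-or-canonical : ∀ {ys} → All Y ys → All X ys ⊎ ∃ Canonical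
  Y*-X*-or-canonical [] = inj₁ []
  Y*-X*-or-canonical (inj₂ (y , canonical , _) ∷ _) = inj₂ (y , canonical)
  Y*-X*-or-canonical (inj₁ x∈X ∷ ys∈Y*) with Y*-X*-or-canonical ys∈Y*
  ... | inj₁ ys∈X* = inj₁ (x∈X ∷ ys∈X*)
  ... | inj₂ canonical = inj₂ canonical

  Y-code : IsCode Y
  Y-code ys ys' ys∈Y* ys'∈Y* eq with Y*-X*-or-canonical ys∈Y* | Y*-X*-or-canonical ys'∈Y*
  ... | inj₁ ys∈X* | inj₁ ys'∈X* = X-code ys ys' ys∈X* ys'∈X* eq
  ... | inj₂ (_ , canonical) | _ = Y-at.Y-code canonical ys ys' ys∈Y* ys'∈Y* eq
  ... | inj₁ _ | inj₂ (_ , canonical) = Y-at.Y-code canonical ys ys' ys∈Y* ys'∈Y* eq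

  θ-Y : ∀ {w} → Y w → Y (θ w)
  θ-Y {w} (inj₁ w∈X) = inj₁ (proj₁ X-invariant w w∈X)
  θ-Y (inj₂ (y , canonical , w∈W)) = inj₂ (y , canonical , Y-at.θ-W canonical w∈W)

  Y-invariant : Invariant θ Y
  Y-invariant = (λ w → θ-Y) , (λ w w∈Y → θ w , θ-Y w∈Y , θ-involutive w)

  Y-complete : Complete Y
  Y-complete w with factor-of-X*? w
  ... | yes w∈F = factor-of-star-mono inj₁ w∈F
  ... | no w∉F = Y-at.Y-complete (proj₂ (canonical-exists w∉F)) w

proposition2 : ∀ (n : ℕ) (θ : Word n → Word n) → LiteralAntimorphism θ →
    ¬ (∀ w → θ w ≡ θ₀ w) → Involutive θ →
    ∀ (X : Lang n) → ¬ Complete X → Regular X → Invariant θ X → IsCode X →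
    ∃[ Y ] ((∀ w → X w → Y w) × IsCode Y × Invariant θ Y × Complete Y)
-- ¬ Complete X is unused: for complete X no y is canonical and Y is X itself.
proposition2 n θ θ-antimorphism θ≢θ₀ θ-involutive X _ X-regular X-invariant X-code =
  Y , (λ w → inj₁) , Y-code , Y-invariant , Y-complete
  where open Extension θ-antimorphism θ≢θ₀ θ-involutive X-regular X-invariant X-code
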